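{- Let $A,B$ be connected, non-trivial graphs, and $f:V(A)\to V(B)$ a function. Then a vertex $(a,b)\in V(A\otimes_f B)$ is a separating vertex of $A\otimes_f B$ if and only if one of the following conditions holds: (i) $a$ is a separating vertex of $A$, and there exists a partition $H_1,H_2,\dots,H_n$, $n\geq 2$, of $V(A-a)$ such that: whenever $h_i\in H_i$ and $h'$ lies in the same connected component of $A-a$ as $h_i$, then $h'\in H_i$; and whenever $h_i\in H_i$ and $h_j\in H_j$ with $i\neq j$ are both neighbours of $a$, the vertex $b$ lies on every path in $B$ from $f(h_i)$ to $f(h_j)$; (ii) $b$ is a separating vertex of $B$, and there exists a connected component $J$ of $B-b$ that is disjoint from the set $\{f(a') : aa'\in E(A)\}$; (iii) $f(a')=b$ for every neighbour $a'$ of $a$ in $A$.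
   Context: All graphs are finite and simple. A graph is non-trivial if it has more than one vertex. A separating vertex of a graph $G$ is a vertex whose removal increases the number of connected components. For graphs $A,B$ and a function $f:V(A)\to V(B)$, the Sierpiński product $A\otimes_f B$ is the graph with vertex set $V(A)\times V(B)$ and edge set $\{(a,b_1)(a,b_2): a\in V(A),\ b_1b_2\in E(B)\}\cup\{(a_1,f(a_2))(a_2,f(a_1)) : a_1a_2\in E(A)\}$. -}

module Defs where

open import Data.Nat using (ℕ; _≤_)
open import Data.Fin using (Fin)
open import Data.Fin.Properties using () renaming (_≟_ to _≟ᶠ_)
open import Data.Product using (Σ; ∃; _×_; _,_)
open import Data.Sum using (_⊎_; inj₁; inj₂)
open import Data.List using (List; []; _∷_)
open import Data.List.Relation.Unary.All using (All)
open import Data.List.Relation.Unary.Unique.Propositional using (Unique)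
open import Data.List.Membership.Propositional using (_∈_)
open import Relation.Nullary using (¬_; Dec; yes; no)
open import Relation.Nullary.Decidable using (_×-dec_; _⊎-dec_)
open import Relation.Binary.PropositionalEquality using (_≡_; _≢_; refl)

record Graph (V : Set) : Set₁ where
  field
    Adj    : V → V → Set
    adj?   : ∀ u v → Dec (Adj u v)
    adj-sym : ∀ {u v} → Adj u v → Adj v u
    adj-irrefl : ∀ {v} → ¬ Adj v v
open Graph public

data Walk {V : Set} (G : Graph V) : V → V → Set where
  stay : ∀ {v} → Walk G v v
  step : ∀ {u v w} → Adj G u v → Walk G v w → Walk G u w

verts : ∀ {V} {G : Graph V} {u w : V} → Walk G u w → List V
verts {u = u} stay = u ∷ []
verts {u = u} (step _ p) = u ∷ verts p

IsPath : ∀ {V} {G : Graph V} {u w : V} → Walk G u w → Set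
IsPath p = Unique (verts p)

Connected : ∀ {V} → Graph V → Set
Connected G = ∀ u w → Walk G u w

-- u and w are joined in G - v (by a walk of G all of whose vertices differ from v).
ConnectedAvoiding : ∀ {V} → Graph V → V → V → V → Set
ConnectedAvoiding G v u w = Σ (Walk G u w) (λ p → All (λ z → z ≢ v) (verts p))

-- v is a separating vertex of G: removing v increases the number of
-- connected components, i.e. the component of G containing v falls apart
-- into at least two components of G - v: there are u, w ≠ v joined in G
-- but not joined in G - v.
Separating : ∀ {V} → Graph V → V → Set
Separating G v =
  ∃ λ u → ∃ λ w → u ≢ v × w ≢ v × Walk G u w × ¬ ConnectedAvoiding G v u w

SAdj : ∀ {m n} (A : Graph (Fin m)) (B : Graph (Fin n)) (f : Fin m → Fin n) →
       Fin m × Fin n → Fin m × Fin n → Set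
SAdj A B f (a₁ , b₁) (a₂ , b₂) =
  (a₁ ≡ a₂ × Adj B b₁ b₂) ⊎ (Adj A a₁ a₂ × (b₁ ≡ f a₂ × b₂ ≡ f a₁))

sierpinski : ∀ {m n} (A : Graph (Fin m)) (B : Graph (Fin n)) (f : Fin m → Fin n) →
             Graph (Fin m × Fin n)
sierpinski A B f = record
  { Adj = SAdj A B f
  ; adj? = λ { (a₁ , b₁) (a₂ , b₂) →
      ((a₁ ≟ᶠ a₂) ×-dec adj? B b₁ b₂) ⊎-dec
      (adj? A a₁ a₂ ×-dec ((b₁ ≟ᶠ f a₂) ×-dec (b₂ ≟ᶠ f a₁))) }
  ; adj-sym = λ { (inj₁ (refl , e)) → inj₁ (refl , adj-sym B e)
            ; (inj₂ (e , p , q)) → inj₂ (adj-sym A e , q , p) }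
  ; adj-irrefl = λ { (inj₁ (_ , e)) → adj-irrefl B e
               ; (inj₂ (e , _)) → adj-irrefl A e }
  }

syntax sierpinski A B f = A ⊗[ f ] B

-- Condition (i): a is separating in A, and there is a partition of V(A - a)
-- into k ≥ 2 nonempty blocks (block of x given by c x, meaningful for x ≠ a)
-- which is a union of components of A - a and such that b lies on every
-- path of B from f(h) to f(h') whenever h, h' are neighbours of a in
-- different blocks.
Cond1 : ∀ {m n} (A : Graph (Fin m)) (B : Graph (Fin n)) (f : Fin m → Fin n) →
        Fin m → Fin n → Set
Cond1 {m} A B f a b =
  Separating A a ×
  ∃ λ (k : ℕ) → Σ (Fin m → Fin k) λ c →
    2 ≤ k ×
    (∀ (i : Fin k) → ∃ λ x → x ≢ a × c x ≡ i) ×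
    (∀ h h' → h ≢ a → ConnectedAvoiding A a h h' → c h ≡ c h') ×
    (∀ h h' → Adj A a h → Adj A a h' → c h ≢ c h' →
       ∀ (p : Walk B (f h) (f h')) → IsPath p → b ∈ verts p)

-- Condition (ii): b is separating in B and some component J of B - b
-- (the component of y ≠ b) contains no f(a') with a' a neighbour of a.
Cond2 : ∀ {m n} (A : Graph (Fin m)) (B : Graph (Fin n)) (f : Fin m → Fin n) →
        Fin m → Fin n → Set
Cond2 A B f a b =
  Separating B b ×
  ∃ λ y → y ≢ b × (∀ a' → Adj A a a' → ¬ ConnectedAvoiding B b y (f a'))

Cond3 : ∀ {m n} (A : Graph (Fin m)) (B : Graph (Fin n)) (f : Fin m → Fin n) →
        Fin m → Fin n → Set
Cond3 A B f a b = ∀ a' → Adj A a a' → f a' ≡ b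

-- Write v = (a , b) and P = A ⊗_f B. In P - v every vertex (x , y) with x ≠ a reaches the row
-- vertex (x , b) inside its copy of B, and a vertex (a , y) reaches the row vertex (a' , b) of a
-- neighbour a' of a whose image f a' lies in the component of y in B - b; if no neighbour
-- qualifies, (ii) or (iii) holds. Row vertices (x , b) and (x' , b) are joined in P - v when x, x'
-- are joined in A - a, or when x, x' are neighbours of a whose images are joined in B - b. Hence if
-- v separates two row vertices, the row vertices reachable from one of them form a block of a
-- partition as in (i). Conversely each of (i)-(iii) gives a set of vertices of P, closed under the
-- edges of P - v, that contains one vertex but not another. The two blocks are defined by a case
-- split on reachability in P - v, which is decidable by a bounded search.

module Submission where

open import Defs
open import Data.Empty using (⊥-elim)
open import Data.Fin using (Fin; zero; suc; _≟_; punchIn)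
import Data.Fin.Properties as Fin
open import Data.List using (List; length; lookup)
open import Data.List.Membership.Propositional using (_∈_; _∉_; lose)
open import Data.List.Membership.Propositional.Properties using (∈-lookup; ∈-allFin; ∈-cartesianProduct⁺)
open import Data.List.Relation.Binary.Subset.Propositional using (_⊆_)
open import Data.List.Relation.Binary.Subset.Propositional.Properties using (⊆-refl; All-resp-⊇; ∈-∷⁺ʳ)
open import Data.List.Relation.Unary.All as All using (All; []; _∷_)
open import Data.List.Relation.Unary.All.Properties using (¬Any⇒All¬)
open import Data.List.Relation.Unary.Any as Any using (Any; here; there; index; satisfied)
open import Data.List.Relation.Unary.Any.Properties using (lookup-index)
open import Data.List.Relation.Unary.AllPairs using ([]; _∷_)
open import Data.List.Relation.Unary.Unique.Propositional using (Unique)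
open import Data.Nat using (ℕ; zero; suc; _≤_; z≤n; s≤s)
open import Data.Product using (Σ; ∃; _×_; _,_; proj₁; proj₂)
open import Data.Product.Properties using (≡-dec)
open import Data.Sum using (_⊎_; inj₁; inj₂)
open import Function using (_∘_)
open import Function.Bundles using (_⇔_; mk⇔; Inverse)
open import Relation.Binary.Definitions using (DecidableEquality)
open import Relation.Binary.PropositionalEquality using (_≡_; _≢_; refl; sym; trans; cong; module ≡-Reasoning)
open import Relation.Nullary using (¬_; Dec; yes; no; does; ¬?)
open import Relation.Nullary.Decidable using (map′; _×-dec_; dec-true; dec-false; does-⇔; decidable-stable)

module _ {A : Set} where

  Unique⇒lookup-injective : ∀ {xs : List A} → Unique xs → ∀ i j → lookup xs i ≡ lookup xs j → i ≡ j
  Unique⇒lookup-injective (_ ∷ _) zero zero _ = refl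
  Unique⇒lookup-injective (x∉xs ∷ _) zero (suc j) eq = ⊥-elim (All.lookup x∉xs (∈-lookup j) eq)
  Unique⇒lookup-injective (x∉xs ∷ _) (suc i) zero eq = ⊥-elim (All.lookup x∉xs (∈-lookup i) (sym eq))
  Unique⇒lookup-injective (_ ∷ u) (suc i) (suc j) eq = cong suc (Unique⇒lookup-injective u i j eq)

  Unique-⊆⇒length≤ : ∀ {xs ys : List A} → Unique xs → xs ⊆ ys → length xs ≤ length ys
  Unique-⊆⇒length≤ {xs} {ys} u xs⊆ys = Fin.injective⇒≤ position-injective
    where
    position : Fin (length xs) → Fin (length ys)
    position i = index (xs⊆ys (∈-lookup i))

    position-injective : ∀ {i j} → position i ≡ position j → i ≡ j
    position-injective {i} {j} eq = Unique⇒lookup-injective u i j (begin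
      lookup xs i            ≡⟨ lookup-index (xs⊆ys (∈-lookup i)) ⟩
      lookup ys (position i) ≡⟨ cong (lookup ys) eq ⟩
      lookup ys (position j) ≡⟨ sym (lookup-index (xs⊆ys (∈-lookup j))) ⟩
      lookup xs j            ∎)
      where open ≡-Reasoning

,-≢ˡ : ∀ {A B : Set} {x x' : A} {y y' : B} → x ≢ x' → (x , y) ≢ (x' , y')
,-≢ˡ x≢x' = x≢x' ∘ cong proj₁

,-≢ʳ : ∀ {A B : Set} {x x' : A} {y y' : B} → y ≢ y' → (x , y) ≢ (x' , y')
,-≢ʳ y≢y' = y≢y' ∘ cong proj₂

∃≢ : ∀ {n} → 2 ≤ n → (i : Fin n) → ∃ λ j → j ≢ i
∃≢ (s≤s (s≤s _)) i = punchIn i zero , Fin.punchInᵢ≢i i zero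

ClosedAvoiding : ∀ {V} → Graph V → V → (V → Set) → Set
ClosedAvoiding G v S = ∀ {x y} → x ≢ v → y ≢ v → Adj G x y → S x → S y

module _ {V : Set} {G : Graph V} where

  adj⇒≢ : ∀ {u w} → Adj G u w → u ≢ w
  adj⇒≢ e refl = adj-irrefl G e

  infixr 5 _++ʷ_
  _++ʷ_ : ∀ {u v w} → Walk G u v → Walk G v w → Walk G u w
  stay ++ʷ q = q
  step e p ++ʷ q = step e (p ++ʷ q)

  reverse : ∀ {u w} → Walk G u w → Walk G w u
  reverse stay = stay
  reverse (step e p) = reverse p ++ʷ step (adj-sym G e) stay

  module _ {P : V → Set} where

    All-head : ∀ {u w} (p : Walk G u w) → All P (verts p) → P u
    All-head stay (pu ∷ _) = pu
    All-head (step _ _) (pu ∷ _) = pu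

    All-last : ∀ {u w} (p : Walk G u w) → All P (verts p) → P w
    All-last stay (pw ∷ _) = pw
    All-last (step _ p) (_ ∷ ps) = All-last p ps

    All-++ʷ : ∀ {u v w} (p : Walk G u v) (q : Walk G v w) →
              All P (verts p) → All P (verts q) → All P (verts (p ++ʷ q))
    All-++ʷ stay _ _ qs = qs
    All-++ʷ (step _ p) q (pu ∷ ps) qs = pu ∷ All-++ʷ p q ps qs

    All-reverse : ∀ {u w} (p : Walk G u w) → All P (verts p) → All P (verts (reverse p))
    All-reverse stay ps = ps
    All-reverse (step _ p) (pu ∷ ps) =
      All-++ʷ (reverse p) _ (All-reverse p ps) (All-head p ps ∷ pu ∷ [])

  module _ {v : V} where

    CA-refl : ∀ {u} → u ≢ v → ConnectedAvoiding G v u u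
    CA-refl u≢v = stay , u≢v ∷ []

    CA-edge : ∀ {u w} → u ≢ v → w ≢ v → Adj G u w → ConnectedAvoiding G v u w
    CA-edge u≢v w≢v e = step e stay , u≢v ∷ w≢v ∷ []

    CA-sym : ∀ {u w} → ConnectedAvoiding G v u w → ConnectedAvoiding G v w u
    CA-sym (p , p≢v) = reverse p , All-reverse p p≢v

    CA-trans : ∀ {u u' w} → ConnectedAvoiding G v u u' → ConnectedAvoiding G v u' w →
               ConnectedAvoiding G v u w
    CA-trans (p , p≢v) (q , q≢v) = p ++ʷ q , All-++ʷ p q p≢v q≢v

    CA-head : ∀ {u w} → ConnectedAvoiding G v u w → u ≢ v
    CA-head (p , p≢v) = All-head p p≢v

    CA-last : ∀ {u w} → ConnectedAvoiding G v u w → w ≢ v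
    CA-last (p , p≢v) = All-last p p≢v

    ∉-verts⇒CA : ∀ {u w} (p : Walk G u w) → v ∉ verts p → ConnectedAvoiding G v u w
    ∉-verts⇒CA p v∉p = p , All.map (_∘ sym) (¬Any⇒All¬ (verts p) v∉p)

  CA-invariant : ∀ {v u w} (S : V → Set) → ClosedAvoiding G v S →
                 ConnectedAvoiding G v u w → S u → S w
  CA-invariant S closed (stay , _) su = su
  CA-invariant S closed (step e p , u≢v ∷ p≢v) su =
    CA-invariant S closed (p , p≢v) (closed u≢v (All-head p p≢v) e su)

  invariant⇒separating : ∀ {v} (S : V → Set) → Connected G → ∀ u w → u ≢ v → w ≢ v →
                         ClosedAvoiding G v S → S u → ¬ S w → Separating G v
  invariant⇒separating S connected u w u≢v w≢v closed su ¬sw =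
    u , w , u≢v , w≢v , connected u w , λ ca → ¬sw (CA-invariant S closed ca su)

  PathWithin : List V → V → V → Set
  PathWithin vs u w = Σ (Walk G u w) λ q → IsPath q × verts q ⊆ vs

  module _ (_≟ⱽ_ : DecidableEquality V) where
    open import Data.List.Membership.DecPropositional _≟ⱽ_ using (_∈?_)

    suffix : ∀ {u v w} (p : Walk G v w) → IsPath p → u ∈ verts p → PathWithin (verts p) u w
    suffix stay p-path (here refl) = stay , p-path , ⊆-refl
    suffix (step e p) p-path (here refl) = step e p , p-path , ⊆-refl
    suffix (step e p) (_ ∷ p-path) (there u∈p) with suffix p p-path u∈p
    ... | q , q-path , q⊆p = q , q-path , there ∘ q⊆p

    toPath : ∀ {u w} (p : Walk G u w) → PathWithin (verts p) u w
    toPath stay = stay , [] ∷ [] , ⊆-refl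
    toPath {u} (step e p) with toPath p
    ... | q , q-path , q⊆p with u ∈? verts q
    ...   | yes u∈q with suffix q q-path u∈q
    ...     | r , r-path , r⊆q = r , r-path , there ∘ q⊆p ∘ r⊆q
    toPath (step e p) | q , q-path , q⊆p | no u∉q =
      step e q , ¬Any⇒All¬ (verts q) u∉q ∷ q-path , ∈-∷⁺ʳ (here refl) (there ∘ q⊆p)

    CA⇒avoiding-path : ∀ {v u w} → ConnectedAvoiding G v u w →
                       ∃ λ (q : Walk G u w) → IsPath q × v ∉ verts q
    CA⇒avoiding-path (p , p≢v) with toPath p
    ... | q , q-path , q⊆p = q , q-path , λ v∈q → All.lookup p≢v (q⊆p v∈q) refl

    module _ {els : List V} (complete : ∀ x → x ∈ els) where

      ShortCA : V → ℕ → V → V → Set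
      ShortCA v k u w = Σ (Walk G u w) λ p → All (_≢ v) (verts p) × length (verts p) ≤ k

      ShortCA? : ∀ v k u w → Dec (ShortCA v k u w)
      ShortCA? v zero u w = no λ { (stay , _ , ()) ; (step _ _ , _ , ()) }
      ShortCA? v (suc k) u w with u ≟ⱽ v | u ≟ⱽ w
      ... | yes refl | _ = no λ (p , p≢v , _) → All-head p p≢v refl
      ... | no u≢v | yes refl = yes (stay , u≢v ∷ [] , s≤s z≤n)
      ... | no u≢v | no u≢w =
        map′ extend restrict (Any.any? (λ z → adj? G u z ×-dec ShortCA? v k z w) els)
        where
        extend : Any (λ z → Adj G u z × ShortCA v k z w) els → ShortCA v (suc k) u w
        extend any with satisfied any
        ... | _ , e , p , p≢v , p-short = step e p , u≢v ∷ p≢v , s≤s p-short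
        restrict : ShortCA v (suc k) u w → Any (λ z → Adj G u z × ShortCA v k z w) els
        restrict (stay , _) = ⊥-elim (u≢w refl)
        restrict (step e p , _ ∷ p≢v , s≤s p-short) = lose (complete _) (e , p , p≢v , p-short)

      -- An avoiding walk shortens to an avoiding path, which has at most length els vertices.
      CA? : ∀ v u w → Dec (ConnectedAvoiding G v u w)
      CA? v u w = map′ (λ (p , p≢v , _) → p , p≢v) shorten (ShortCA? v (length els) u w)
        where
        shorten : ConnectedAvoiding G v u w → ShortCA v (length els) u w
        shorten (p , p≢v) with toPath p
        ... | q , q-path , q⊆p =
          q , All-resp-⊇ q⊆p p≢v , Unique-⊆⇒length≤ q-path (λ _ → complete _)

module SierpińskiProduct {m n} (A : Graph (Fin m)) (B : Graph (Fin n)) (f : Fin m → Fin n) where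

  P : Graph (Fin m × Fin n)
  P = A ⊗[ f ] B

  copy : ∀ x {y z} → Walk B y z → Walk P (x , y) (x , z)
  copy x stay = stay
  copy x (step e p) = step (inj₁ (refl , e)) (copy x p)

  All-copy : ∀ {Q : Fin m × Fin n → Set} x {y z} (p : Walk B y z) →
             All (λ z → Q (x , z)) (verts p) → All Q (verts (copy x p))
  All-copy x stay (q ∷ []) = q ∷ []
  All-copy x (step _ p) (q ∷ qs) = q ∷ All-copy x p qs

  bridge : ∀ {x x'} → Adj A x x' → Adj P (x , f x') (x' , f x)
  bridge e = inj₂ (e , refl , refl)

  module _ (connectedB : Connected B) where

    lift : ∀ {x x'} → Walk A x x' → ∀ y y' → Walk P (x , y) (x' , y')
    lift {x} stay y y' = copy x (connectedB y y')
    lift {x} (step {v = x''} e p) y y' =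
      copy x (connectedB y (f x'')) ++ʷ step (bridge e) (lift p (f x) y')

    connected : Connected A → Connected P
    connected connectedA (x , y) (x' , y') = lift (connectedA x x') y y'

module SeparatingVertex {m n} (A : Graph (Fin m)) (B : Graph (Fin n)) (f : Fin m → Fin n)
  (connectedA : Connected A) (connectedB : Connected B) (a : Fin m) (b : Fin n) where

  open SierpińskiProduct A B f

  CAᴮ? : ∀ y z → Dec (ConnectedAvoiding B b y z)
  CAᴮ? = CA? _≟_ ∈-allFin b

  CAᴾ? : ∀ u w → Dec (ConnectedAvoiding P (a , b) u w)
  CAᴾ? = CA? (≡-dec _≟_ _≟_) (λ (x , y) → ∈-cartesianProduct⁺ (∈-allFin x) (∈-allFin y)) (a , b)

  copy-CA : ∀ {x y z} → x ≢ a → Walk B y z → ConnectedAvoiding P (a , b) (x , y) (x , z)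
  copy-CA {x} x≢a p = copy x p , All-copy x p (All.universal (λ _ → ,-≢ˡ x≢a) (verts p))

  copy-CAᴮ : ∀ {x y z} → ConnectedAvoiding B b y z → ConnectedAvoiding P (a , b) (x , y) (x , z)
  copy-CAᴮ {x} (p , p≢b) = copy x p , All-copy x p (All.map ,-≢ʳ p≢b)

  lift-CA : ∀ {x x'} → ConnectedAvoiding A a x x' → ∀ y y' →
            ConnectedAvoiding P (a , b) (x , y) (x' , y')
  lift-CA (stay , x≢a ∷ []) y y' = copy-CA x≢a (connectedB y y')
  lift-CA {x} (step {v = x''} e p , x≢a ∷ p≢a) y y' =
    CA-trans (copy-CA x≢a (connectedB y (f x'')))
      (CA-trans (CA-edge (,-≢ˡ x≢a) (,-≢ˡ (All-head p p≢a)) (bridge e))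
        (lift-CA (p , p≢a) (f x) y'))

  neighbour≢a : ∀ {a'} → Adj A a a' → a' ≢ a
  neighbour≢a e = adj⇒≢ {G = A} (adj-sym A e)

  neighbour-row : ∀ {a' y} → Adj A a a' → ConnectedAvoiding B b y (f a') →
                  ConnectedAvoiding P (a , b) (a , y) (a' , b)
  neighbour-row e ca =
    CA-trans (copy-CAᴮ ca)
      (CA-trans (CA-edge (,-≢ʳ (CA-last ca)) (,-≢ˡ (neighbour≢a e)) (bridge e))
        (copy-CA (neighbour≢a e) (connectedB (f a) b)))

  neighbour-rows : ∀ {h h'} → Adj A a h → Adj A a h' → ConnectedAvoiding B b (f h) (f h') →
                   ConnectedAvoiding P (a , b) (h , b) (h' , b)
  neighbour-rows ah ah' ca =
    CA-trans (CA-sym (neighbour-row ah (CA-refl (CA-head ca)))) (neighbour-row ah' ca)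

  connectedP : Connected P
  connectedP = connected connectedB connectedA

  Cond3⇒separating : 2 ≤ m → 2 ≤ n → Cond3 A B f a b → Separating P (a , b)
  Cond3⇒separating 2≤m 2≤n neighbours↦b with ∃≢ 2≤m a | ∃≢ 2≤n b
  ... | a' , a'≢a | y , y≢b =
    invariant⇒separating {G = P} InCopy connectedP (a , y) (a' , b)
      (,-≢ʳ y≢b) (,-≢ˡ a'≢a) closed refl a'≢a
    where
    InCopy : Fin m × Fin n → Set
    InCopy (x , _) = x ≡ a
    closed : ClosedAvoiding P (a , b) InCopy
    closed _ _ (inj₁ (refl , _)) x≡a = x≡a
    closed u≢ab _ (inj₂ (e , refl , _)) refl = ⊥-elim (u≢ab (cong (a ,_) (neighbours↦b _ e)))

  Cond2⇒separating : 2 ≤ m → Cond2 A B f a b → Separating P (a , b)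
  Cond2⇒separating 2≤m (_ , y , y≢b , unreached) with ∃≢ 2≤m a
  ... | a' , a'≢a =
    invariant⇒separating {G = P} InCopyReached connectedP (a , y) (a' , b)
      (,-≢ʳ y≢b) (,-≢ˡ a'≢a) closed (refl , CA-refl y≢b) (a'≢a ∘ proj₁)
    where
    InCopyReached : Fin m × Fin n → Set
    InCopyReached (x , z) = x ≡ a × ConnectedAvoiding B b y z
    closed : ClosedAvoiding P (a , b) InCopyReached
    closed u≢ab v≢ab (inj₁ (refl , e)) (refl , ca) =
      refl , CA-trans ca (CA-edge (u≢ab ∘ cong (a ,_)) (v≢ab ∘ cong (a ,_)) e)
    closed _ _ (inj₂ (e , refl , _)) (refl , ca) = ⊥-elim (unreached _ e ca)

  Cond1⇒separating : Cond1 A B f a b → Separating P (a , b)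
  Cond1⇒separating (_ , _ , c , s≤s (s≤s _) , blocks , componentwise , split)
    with blocks zero | blocks (suc zero)
  ... | x₀ , x₀≢a , cx₀ | x₁ , x₁≢a , cx₁ =
    invariant⇒separating {G = P} InBlock₀ connectedP (x₀ , b) (x₁ , b) (,-≢ˡ x₀≢a) (,-≢ˡ x₁≢a)
      closed (inj₁ (x₀≢a , cx₀)) notInBlock₀
    where
    InBlock₀ : Fin m × Fin n → Set
    InBlock₀ (x , z) = (x ≢ a × c x ≡ zero)
                     ⊎ (x ≡ a × ∃ λ h → Adj A a h × c h ≡ zero × ConnectedAvoiding B b (f h) z)

    notInBlock₀ : ¬ InBlock₀ (x₁ , b)
    notInBlock₀ (inj₁ (_ , cx₁≡0)) with trans (sym cx₁) cx₁≡0
    ... | ()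
    notInBlock₀ (inj₂ (x₁≡a , _)) = x₁≢a x₁≡a

    closed : ClosedAvoiding P (a , b) InBlock₀
    closed _ _ (inj₁ (refl , _)) (inj₁ s) = inj₁ s
    closed u≢ab v≢ab (inj₁ (refl , e)) (inj₂ (refl , h , ah , ch , ca)) =
      inj₂ (refl , h , ah , ch , CA-trans ca (CA-edge (u≢ab ∘ cong (a ,_)) (v≢ab ∘ cong (a ,_)) e))
    closed {x , _} {x' , _} _ v≢ab (inj₂ (e , refl , refl)) (inj₁ (x≢a , cx)) with x' ≟ a
    ... | yes refl = inj₂ (refl , x , adj-sym A e , cx , CA-refl (v≢ab ∘ cong (a ,_)))
    ... | no x'≢a = inj₁ (x'≢a , trans (sym (componentwise x x' x≢a (CA-edge x≢a x'≢a e))) cx)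
    closed {y = x' , _} _ _ (inj₂ (e , refl , refl)) (inj₂ (refl , h , ah , ch , ca))
      with c x' ≟ zero | CA⇒avoiding-path _≟_ ca
    ... | yes cx' | _ = inj₁ (neighbour≢a e , cx')
    ... | no cx'≢0 | q , q-path , b∉q =
      ⊥-elim (b∉q (split h x' ah e (λ ch≡cx' → cx'≢0 (trans (sym ch≡cx') ch)) q q-path))

  Conditions : Set
  Conditions = Cond1 A B f a b ⊎ Cond2 A B f a b ⊎ Cond3 A B f a b

  Conditions⇒separating : 2 ≤ m → 2 ≤ n → Conditions → Separating P (a , b)
  Conditions⇒separating _ _ (inj₁ c₁) = Cond1⇒separating c₁
  Conditions⇒separating 2≤m _ (inj₂ (inj₁ c₂)) = Cond2⇒separating 2≤m c₂
  Conditions⇒separating 2≤m 2≤n (inj₂ (inj₂ c₃)) = Cond3⇒separating 2≤m 2≤n c₃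

  unreached⇒Cond2⊎Cond3 : ∀ {y} → y ≢ b → (∀ a' → Adj A a a' → ¬ ConnectedAvoiding B b y (f a')) →
                          Cond2 A B f a b ⊎ Cond3 A B f a b
  unreached⇒Cond2⊎Cond3 {y} y≢b unreached with Fin.any? (λ a' → adj? A a a' ×-dec ¬? (f a' ≟ b))
  ... | yes (a' , e , fa'≢b) =
    inj₁ ((y , f a' , y≢b , fa'≢b , connectedB y (f a') , unreached a' e) , y , y≢b , unreached)
  ... | no none = inj₂ λ a' e → decidable-stable (f a' ≟ b) λ fa'≢b → none (a' , e , fa'≢b)

  Cond2⊎Cond3⊎reaches-row : ∀ u → u ≢ (a , b) →
    (Cond2 A B f a b ⊎ Cond3 A B f a b) ⊎ ∃ λ x → x ≢ a × ConnectedAvoiding P (a , b) u (x , b)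
  Cond2⊎Cond3⊎reaches-row (x , y) u≢ab with x ≟ a
  ... | no x≢a = inj₂ (x , x≢a , copy-CA x≢a (connectedB y b))
  ... | yes refl with Fin.any? (λ a' → adj? A a a' ×-dec CAᴮ? y (f a'))
  ...   | yes (a' , e , ca) = inj₂ (a' , neighbour≢a e , neighbour-row e ca)
  ...   | no none = inj₁ (unreached⇒Cond2⊎Cond3 (u≢ab ∘ cong (a ,_)) λ a' e ca → none (a' , e , ca))

  reachable-rows⇒Cond1 : ∀ {u x₀ x₁} → x₀ ≢ a → x₁ ≢ a →
                         ConnectedAvoiding P (a , b) u (x₀ , b) → ¬ ConnectedAvoiding P (a , b) u (x₁ , b) →
                         Cond1 A B f a b
  reachable-rows⇒Cond1 {u} {x₀} {x₁} x₀≢a x₁≢a r₀ ¬r₁ =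
    (x₀ , x₁ , x₀≢a , x₁≢a , connectedA x₀ x₁ , λ ca → ¬r₁ (CA-trans r₀ (lift-CA ca b b))) ,
    2 , colour , s≤s (s≤s z≤n) , blocks , (λ h h' _ ca → same-colour (lift-CA ca b b)) , split
    where
    colour : Fin m → Fin 2
    colour x = Inverse.from Fin.2↔Bool (does (CAᴾ? u (x , b)))

    same-colour : ∀ {h h'} → ConnectedAvoiding P (a , b) (h , b) (h' , b) → colour h ≡ colour h'
    same-colour r = cong (Inverse.from Fin.2↔Bool)
      (does-⇔ (mk⇔ (λ s → CA-trans s r) (λ s → CA-trans s (CA-sym r))) (CAᴾ? u _) (CAᴾ? u _))

    blocks : ∀ i → ∃ λ x → x ≢ a × colour x ≡ i
    blocks zero = x₁ , x₁≢a , cong (Inverse.from Fin.2↔Bool) (dec-false (CAᴾ? u _) ¬r₁)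
    blocks (suc zero) = x₀ , x₀≢a , cong (Inverse.from Fin.2↔Bool) (dec-true (CAᴾ? u _) r₀)

    split : ∀ h h' → Adj A a h → Adj A a h' → colour h ≢ colour h' →
            ∀ (p : Walk B (f h) (f h')) → IsPath p → b ∈ verts p
    split h h' ah ah' colour≢ p _ = decidable-stable (b ∈? verts p)
      λ b∉p → colour≢ (same-colour (neighbour-rows ah ah' (∉-verts⇒CA p b∉p)))
      where open import Data.List.Membership.DecPropositional _≟_ using (_∈?_)

  separating⇒Conditions : Separating P (a , b) → Conditions
  separating⇒Conditions (u , w , u≢ab , w≢ab , _ , ¬uw)
    with Cond2⊎Cond3⊎reaches-row u u≢ab | Cond2⊎Cond3⊎reaches-row w w≢ab
  ... | inj₁ c | _ = inj₂ c
  ... | inj₂ _ | inj₁ c = inj₂ c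
  ... | inj₂ (x₀ , x₀≢a , r₀) | inj₂ (x₁ , x₁≢a , r₁) =
    inj₁ (reachable-rows⇒Cond1 x₀≢a x₁≢a r₀ λ r → ¬uw (CA-trans r (CA-sym r₁)))

theorem1p1 : ∀ {m n} (A : Graph (Fin m)) (B : Graph (Fin n)) (f : Fin m → Fin n) →
    Connected A → Connected B → 2 ≤ m → 2 ≤ n →
    ∀ (a : Fin m) (b : Fin n) →
      Separating (sierpinski A B f) (a , b) ⇔
        (Cond1 A B f a b ⊎ Cond2 A B f a b ⊎ Cond3 A B f a b)
theorem1p1 A B f connectedA connectedB 2≤m 2≤n a b =
  mk⇔ separating⇒Conditions (Conditions⇒separating 2≤m 2≤n)
  where open SeparatingVertex A B f connectedA connectedB a b
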